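{- Let $G_0$ be a vertex-transitive graph in $\mathcal{G}$ having at least one edge of every label and every orientation allowed in $\mathcal{G}$. Let $n_0=|V(G_0)|$ and let $d$ be the minimum, over all labels and orientations allowed in $\mathcal{G}$, of the number of edges of $G_0$ of the given label and given orientation incident to a vertex of $G_0$. Then the property "to have a homomorphism to $G_0$" is strongly $d/n_0$-extendible in $\mathcal{G}$.
   Context: $\mathcal{G}$ is a class of finite loopless graphs without multiple edges which may have every edge oriented and/or labelled. A homomorphism from $G$ to $H$ is a map $\phi:V(G)\to V(H)$ such that for every edge $\{u,v\}$ of $G$, $\{\phi(u),\phi(v)\}$ is an edge of $H$ with the same label (if labelled), and if $(u,v)$ is oriented from $u$ to $v$ then $(\phi(u),\phi(v))$ is an edge of $H$ oriented from $\phi(u)$ to $\phi(v)$. An automorphism is a bijective homomorphism from a graph to itself; $G$ is vertex-transitive if for all $u,v\in V(G)$ there is an automorphism mapping $u$ to $v$. For $0<\lambda<1$, a property $\Pi\subseteq\mathcal{G}$ is strongly $\lambda$-extendible if: every $G\in\mathcal{G}$ whose underlying simple graph is $K_1$ or $K_2$ is in $\Pi$; $G\in\Pi$ iff each block of $G$ (maximal connected subgraph of the underlying simple graph without a cut vertex, with inherited orientation/labels) is in $\Pi$; and for every $G\in\mathcal{G}$, $S\subseteq V(G)$ with $G[S]\in\Pi$ and $G\setminus S=G[V(G)\setminus S]\in\Pi$, and every $c:E(G)\to\mathbb{R}^+$, there is $F\subseteq\delta(S)$ (edges with exactly one endpoint in $S$) with $c(F)\ge\lambda c(\delta(S))$ such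 that deleting the edges $\delta(S)\setminus F$ from $G$ yields a graph in $\Pi$.
   Formalization: The edge weights c in the definition of strong extendibility take values in the positive rationals rather than in $\mathbb{R}^+$. -}

module Defs where

open import Data.Bool using (Bool; true; false; not; _∧_; _∨_; _xor_; if_then_else_)
open import Data.Nat using (ℕ; zero; suc; _≤_; _<ᵇ_)
open import Data.Fin using (Fin; toℕ; _≟_)
open import Data.Fin.Base using () renaming (zero to f0; suc to fs)
open import Data.List using (List; []; _∷_; allFin; concatMap)
open import Data.Maybe using (Maybe; just; nothing; is-just)
open import Data.Product using (Σ; _×_; _,_; ∃)
open import Data.Sum using (_⊎_)
open import Data.Unit using (⊤)
open import Data.Integer using (+_)
open import Data.Rational using (ℚ; 0ℚ; 1ℚ; _+_; _*_) renaming (_≤_ to _≤ℚ_; _<_ to _<ℚ_)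
open import Relation.Binary.PropositionalEquality using (_≡_)
open import Relation.Nullary.Decidable using (⌊_⌋)
open import Function.Definitions using (Bijective)
open import Function.Bundles using (_⇔_)

-- The class 𝒢 is fixed by two parameters:
--   o : Bool      -- true: every edge is oriented; false: no edge is oriented
--   k : ℕ         -- labels are Fin (suc k) (unlabelled graphs: k = 0)
-- A graph on vertex set V is given by its arc function:
--   G u v = just ℓ  iff there is an edge between u and v with label ℓ,
--   which (in the oriented case) is oriented from u to v.

Graph : ℕ → Set → Set
Graph k V = V → V → Maybe (Fin (suc k))

Compat : Bool → {k : ℕ} → Maybe (Fin (suc k)) → Maybe (Fin (suc k)) → Set
Compat false a b = a ≡ b                     -- undirected: symmetric, same label
Compat true  a b = a ≡ nothing ⊎ b ≡ nothing -- oriented: no two opposite arcs (simple)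

InClass : (o : Bool) {k : ℕ} {V : Set} → Graph k V → Set
InClass o {V = V} G = ((v : V) → G v v ≡ nothing) × ((u v : V) → Compat o (G u v) (G v u))

IsHom : {k : ℕ} {V W : Set} → Graph k V → Graph k W → (V → W) → Set
IsHom {k} {V} G H φ = (u v : V) (ℓ : Fin (suc k)) → G u v ≡ just ℓ → H (φ u) (φ v) ≡ just ℓ

IsAut : {k : ℕ} {V : Set} → Graph k V → (V → V) → Set
IsAut G φ = Bijective _≡_ _≡_ φ × IsHom G G φ

VertexTransitive : {k : ℕ} {V : Set} → Graph k V → Set
VertexTransitive {V = V} G = (u v : V) → Σ (V → V) λ φ → IsAut G φ × φ u ≡ v

HasHomTo : {k n0 : ℕ} → Graph k (Fin n0) → {V : Set} → Graph k V → Set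
HasHomTo {n0 = n0} G0 {V} G = Σ (V → Fin n0) λ φ → IsHom G G0 φ

countB : {A : Set} → (A → Bool) → List A → ℕ
countB p [] = 0
countB p (x ∷ xs) = if p x then suc (countB p xs) else countB p xs

hasLabel : {k : ℕ} → Maybe (Fin (suc k)) → Fin (suc k) → Bool
hasLabel (just x) ℓ = ⌊ x ≟ ℓ ⌋
hasLabel nothing  ℓ = false

-- orientations of an edge relative to an incident vertex
Dir : Bool → Set
Dir false = ⊤
Dir true  = Bool   -- true: outgoing, false: incoming

degree : (o : Bool) {k n : ℕ} → Graph k (Fin n) → Fin n → Fin (suc k) → Dir o → ℕ
degree false {n = n} G v ℓ _     = countB (λ w → hasLabel (G v w) ℓ) (allFin n)
degree true  {n = n} G v ℓ true  = countB (λ w → hasLabel (G v w) ℓ) (allFin n)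
degree true  {n = n} G v ℓ false = countB (λ w → hasLabel (G w v) ℓ) (allFin n)

Subset : ℕ → Set
Subset n = Fin n → Bool

Elem : {n : ℕ} → Subset n → Set
Elem {n} B = Σ (Fin n) λ v → B v ≡ true

induced : {k n : ℕ} → Graph k (Fin n) → (B : Subset n) → Graph k (Elem B)
induced G B (u , _) (v , _) = G u v

adj : {k n : ℕ} → Graph k (Fin n) → Fin n → Fin n → Bool
adj G u v = is-just (G u v) ∨ is-just (G v u)

data Walk {k n : ℕ} (G : Graph k (Fin n)) (B : Subset n) : Fin n → Fin n → Set where
  here : ∀ {v} → B v ≡ true → Walk G B v v
  step : ∀ {u v w} → B u ≡ true → adj G u v ≡ true → Walk G B v w → Walk G B u w

Connected : {k n : ℕ} → Graph k (Fin n) → Subset n → Set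
Connected {n = n} G B = (u v : Fin n) → B u ≡ true → B v ≡ true → Walk G B u v

remove : {n : ℕ} → Subset n → Fin n → Subset n
remove B x v = B v ∧ not ⌊ v ≟ x ⌋

BlockLike : {k n : ℕ} → Graph k (Fin n) → Subset n → Set
BlockLike {n = n} G B =
  (Σ (Fin n) λ v → B v ≡ true) × Connected G B
  × ((x : Fin n) → B x ≡ true → Connected G (remove B x))

IsBlock : {k n : ℕ} → Graph k (Fin n) → Subset n → Set
IsBlock {n = n} G B = BlockLike G B ×
  ((B' : Subset n) → ((v : Fin n) → B v ≡ true → B' v ≡ true) → BlockLike G B'
     → (v : Fin n) → B' v ≡ true → B v ≡ true)

-- cuts and costs.  An edge {u,v} is represented by the pair (u,v) with toℕ u < toℕ v.

isEdgeRep : {k n : ℕ} → Graph k (Fin n) → Fin n → Fin n → Bool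
isEdgeRep G u v = (toℕ u <ᵇ toℕ v) ∧ adj G u v

crossing : {n : ℕ} → Subset n → Fin n → Fin n → Bool
crossing S u v = S u xor S v

sumℚ : List ℚ → ℚ
sumℚ [] = 0ℚ
sumℚ (x ∷ xs) = x + sumℚ xs

pairs : (n : ℕ) → List (Fin n × Fin n)
pairs n = concatMap (λ u → Data.List.map (λ v → (u , v)) (allFin n)) (allFin n)

costOver : {n : ℕ} → (Fin n → Fin n → Bool) → (Fin n → Fin n → ℚ) → ℚ
costOver {n} p c = sumℚ (Data.List.map (λ { (u , v) → if p u v then c u v else 0ℚ }) (pairs n))

cutCost : {k n : ℕ} → Graph k (Fin n) → Subset n → (Fin n → Fin n → ℚ) → ℚ
cutCost G S = costOver (λ u v → isEdgeRep G u v ∧ crossing S u v)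

-- F ⊆ δ(S) is encoded by keep : F = { edges (u,v) of δ(S), toℕ u < toℕ v, keep u v ≡ true }
keepSym : {n : ℕ} → (Fin n → Fin n → Bool) → Fin n → Fin n → Bool
keepSym keep u v = if toℕ u <ᵇ toℕ v then keep u v else keep v u

keptCost : {k n : ℕ} → Graph k (Fin n) → Subset n → (Fin n → Fin n → Bool) → (Fin n → Fin n → ℚ) → ℚ
keptCost G S keep = costOver (λ u v → isEdgeRep G u v ∧ crossing S u v ∧ keep u v)

deleteCut : {k n : ℕ} → Graph k (Fin n) → Subset n → (Fin n → Fin n → Bool) → Graph k (Fin n)
deleteCut G S keep u v = if crossing S u v ∧ not (keepSym keep u v) then nothing else G u v

Property : ℕ → Set₁
Property k = {V : Set} → Graph k V → Set

StronglyExtendible : (o : Bool) (k : ℕ) → ℚ → Property k → Set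
StronglyExtendible o k λ' Π =
  (0ℚ <ℚ λ' × λ' <ℚ 1ℚ)
  × ((G : Graph k (Fin 1)) → InClass o G → Π G)
  × ((G : Graph k (Fin 2)) → InClass o G → adj G f0 (fs f0) ≡ true → Π G)
  × ((n : ℕ) (G : Graph k (Fin n)) → InClass o G →
       Π G ⇔ ((B : Subset n) → IsBlock G B → Π (induced G B)))
  × ((n : ℕ) (G : Graph k (Fin n)) → InClass o G → (S : Subset n) →
       Π (induced G S) → Π (induced G (λ v → not (S v))) →
       (c : Fin n → Fin n → ℚ) →
       ((u v : Fin n) → isEdgeRep G u v ≡ true → 0ℚ <ℚ c u v) →
       Σ (Fin n → Fin n → Bool) λ keep →
         (λ' * cutCost G S c ≤ℚ keptCost G S keep c) × Π (deleteCut G S keep))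

module Submission where

-- A graph maps to G0 iff each of its blocks does: homomorphisms on the two sides of a
-- separation glue, directly when the sides are disjoint and, when they share a cut vertex,
-- after composing one side with an automorphism of G0 matching the two images of that vertex.
--
-- For the extension property fix homomorphisms φ₁ of G[S] and φ₂ of G ∖ S, and let σ range over
-- all endomorphisms of G0; ψ = φ₁ ∪ σ ∘ φ₂ maps G into G0 once the cut edges it does not preserve
-- are deleted. By vertex transitivity the value of σ at any vertex is equidistributed over the
-- n₀ vertices, and at least d vertices z are joined to φ₁ a as b is to a, so each cut edge {a, b}
-- (a ∈ S) is preserved by at least a fraction d / n₀ of the σ. Averaging the preserved cut weight
-- over σ yields a σ keeping at least (d / n₀) c(δ(S)). Finally 0 < d because every label and
-- orientation occurs in the vertex-transitive G0, and d < n₀ because G0 has no loops.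

open import Defs
open import Algebra.Bundles using (CommutativeMonoid)
import Algebra.Properties.CommutativeSemigroup as CommSemigroupProps
open import Axiom.UniquenessOfIdentityProofs.WithK using (uip)
open import Data.Bool using (Bool; true; false; not; _∧_; _∨_; _xor_; if_then_else_)
open import Data.Bool.Properties
  using ( ∧-conicalˡ; ∧-conicalʳ; ∨-conicalˡ; ∨-conicalʳ; ∧-comm; ∨-comm; ∧-identityʳ; ∧-zeroʳ; ∨-zeroʳ
        ; not-involutive; not-¬; if-eta; if-swap-then; if-∧)
  renaming (_≟_ to _≟ᵇ_)
open import Data.Empty using (⊥; ⊥-elim)
open import Data.Fin using (Fin; toℕ; _≟_) renaming (zero to fzero; suc to fsuc)
open import Data.Fin.Properties using (any?; all?)
open import Data.Fin.Subset.Properties using (anySubset?)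
open import Data.Vec as Vec using (Vec; lookup) renaming (tabulate to vtabulate)
open import Data.Vec.Properties using (lookup∘tabulate; tabulate∘lookup; tabulate-cong; ∷-injective)
open import Data.Integer as ℤ using (+_)
import Data.Integer.Properties as ℤ
open import Data.List using (List; []; _∷_; _++_; [_]; length; allFin; filter; map; cartesianProductWith)
open import Data.List.Membership.Propositional using (_∈_; _∉_; lose)
open import Data.List.Membership.Propositional.Properties
  using ( ∈-allFin; ∈-cartesianProductWith⁺; ∈-∃++; ∈-++⁺ˡ; ∈-++⁺ʳ; ∈-++⁻
        ; ∈-filter⁺; ∈-filter⁻; ∈-map⁻)
open import Data.List.Properties using (length-++; length-tabulate; length-map)
open import Data.List.Relation.Unary.All as All using ()
open import Data.List.Relation.Unary.Any as Any using (here; there; satisfied)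
open import Data.List.Relation.Unary.Unique.Propositional using (Unique; []; _∷_)
import Data.List.Relation.Unary.Unique.Propositional.Properties as Unique
open import Data.Maybe using (Maybe; just; nothing; is-just)
open import Data.Maybe.Properties using () renaming (≡-dec to ≡-decMaybe)
open import Data.Nat as ℕ using (ℕ; zero; suc; _+_; _*_; _≤_; _<_; z≤n; s≤s)
import Data.Nat.Properties as ℕ
open import Data.Product using (Σ; _×_; _,_; proj₁; proj₂; ∃)
open import Data.Rational as ℚ using (ℚ; 0ℚ; 1ℚ; _/_)
import Data.Rational.Properties as ℚ
open import Data.Rational.Literals using (fromℤ)
open import Data.Rational.Unnormalised as ℚᵘ using (mkℚᵘ)
import Data.Rational.Unnormalised.Properties as ℚᵘ
open import Data.Sum using (_⊎_; inj₁; inj₂)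
open import Function.Bundles using (_⇔_; mk⇔)
open import Relation.Binary.PropositionalEquality
  using (_≡_; _≢_; refl; sym; trans; cong; cong₂; subst; subst₂; module ≡-Reasoning)
open import Relation.Nullary using (Dec; yes; no; ¬_)
open import Relation.Nullary.Decidable using (⌊_⌋; isYes≗does; dec-true; dec-false; _×-dec_; _→-dec_; ¬?)

open CommSemigroupProps (CommutativeMonoid.commutativeSemigroup ℕ.+-0-commutativeMonoid)
  using () renaming (interchange to +-interchange)
open CommSemigroupProps (CommutativeMonoid.commutativeSemigroup ℚ.+-0-commutativeMonoid)
  using () renaming (interchange to +-interchangeℚ)

private
  variable
    X : Set

isYes-sound : {P : Set} (p? : Dec P) → ⌊ p? ⌋ ≡ true → P
isYes-sound (yes p) _ = p

isYes-complete : {P : Set} (p? : Dec P) → P → ⌊ p? ⌋ ≡ true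
isYes-complete p? p = trans (isYes≗does p?) (dec-true p? p)

isYes-false : {P : Set} (p? : Dec P) → ¬ P → ⌊ p? ⌋ ≡ false
isYes-false p? ¬p = trans (isYes≗does p?) (dec-false p? ¬p)

true≢false : {b : Bool} → b ≡ true → b ≢ false
true≢false = not-¬

-- Counting and finite sums

countB-true : (xs : List X) → countB (λ _ → true) xs ≡ length xs
countB-true []       = refl
countB-true (_ ∷ xs) = cong suc (countB-true xs)

countB-false : (xs : List X) → countB (λ _ → false) xs ≡ 0
countB-false []       = refl
countB-false (_ ∷ xs) = countB-false xs

countB-cong : {p q : X → Bool} → (∀ x → p x ≡ q x) → (xs : List X) → countB p xs ≡ countB q xs
countB-cong p≗q [] = refl
countB-cong {p = p} {q} p≗q (x ∷ xs) rewrite p≗q x with q x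
... | true  = cong suc (countB-cong p≗q xs)
... | false = countB-cong p≗q xs

countB-mono : (p q : X → Bool) → (∀ x → p x ≡ true → q x ≡ true) →
              (xs : List X) → countB p xs ≤ countB q xs
countB-mono p q p⇒q [] = z≤n
countB-mono p q p⇒q (x ∷ xs) with p x in px | q x in qx
... | true  | true  = s≤s (countB-mono p q p⇒q xs)
... | true  | false = ⊥-elim (true≢false (p⇒q x px) qx)
... | false | true  = ℕ.m≤n⇒m≤1+n (countB-mono p q p⇒q xs)
... | false | false = countB-mono p q p⇒q xs

countB-mono-< : (p q : X → Bool) → (∀ x → p x ≡ true → q x ≡ true) →
                {xs : List X} {x : X} → x ∈ xs → p x ≡ false → q x ≡ true →
                countB p xs < countB q xs
countB-mono-< p q p⇒q {_ ∷ xs} (here refl) px qx rewrite px | qx = s≤s (countB-mono p q p⇒q xs)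
countB-mono-< p q p⇒q {y ∷ xs} (there x∈xs) px qx with p y in py | q y in qy
... | true  | true  = s≤s (countB-mono-< p q p⇒q x∈xs px qx)
... | true  | false = ⊥-elim (true≢false (p⇒q y py) qy)
... | false | true  = ℕ.m≤n⇒m≤1+n (countB-mono-< p q p⇒q x∈xs px qx)
... | false | false = countB-mono-< p q p⇒q x∈xs px qx

countB-≤-length : (p : X → Bool) (xs : List X) → countB p xs ≤ length xs
countB-≤-length p xs = subst (countB p xs ≤_) (countB-true xs) (countB-mono p _ (λ _ _ → refl) xs)

countB-<-length : (p : X → Bool) {xs : List X} {x : X} → x ∈ xs → p x ≡ false → countB p xs < length xs
countB-<-length p {xs} x∈xs px =
  subst (countB p xs <_) (countB-true xs) (countB-mono-< p _ (λ _ _ → refl) x∈xs px refl)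

countB-pos : (p : X → Bool) {xs : List X} {x : X} → x ∈ xs → p x ≡ true → 0 < countB p xs
countB-pos p {xs} x∈xs px = subst (_< countB p xs) (countB-false xs) (countB-mono-< _ p (λ _ ()) x∈xs refl px)

countB≡length∘filter : (p : X → Bool) (xs : List X) → countB p xs ≡ length (filter (λ x → p x ≟ᵇ true) xs)
countB≡length∘filter p [] = refl
countB≡length∘filter p (x ∷ xs) with p x
... | true  = cong suc (countB≡length∘filter p xs)
... | false = countB≡length∘filter p xs

Unique∧⊆⇒length-≤ : {xs ys : List X} → Unique xs → (∀ {x} → x ∈ xs → x ∈ ys) → length xs ≤ length ys
Unique∧⊆⇒length-≤ {xs = []} _ _ = z≤n
Unique∧⊆⇒length-≤ {xs = x ∷ xs} (x∉xs ∷ uniq) xs⊆ys with ∈-∃++ (xs⊆ys (here refl))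
... | as , bs , refl = begin
    suc (length xs)                ≤⟨ s≤s (Unique∧⊆⇒length-≤ uniq xs⊆as++bs) ⟩
    suc (length (as ++ bs))        ≡⟨ cong suc (length-++ as) ⟩
    suc (length as + length bs)    ≡⟨ ℕ.+-suc (length as) (length bs) ⟨
    length as + length (x ∷ bs)    ≡⟨ length-++ as ⟨
    length (as ++ [ x ] ++ bs)     ∎
  where
  open ℕ.≤-Reasoning
  xs⊆as++bs : ∀ {y} → y ∈ xs → y ∈ as ++ bs
  xs⊆as++bs y∈xs with ∈-++⁻ as (xs⊆ys (there y∈xs))
  ... | inj₁ y∈as         = ∈-++⁺ˡ y∈as
  ... | inj₂ (here refl)  = ⊥-elim (All.lookup x∉xs y∈xs refl)
  ... | inj₂ (there y∈bs) = ∈-++⁺ʳ as y∈bs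

countB-injection : {xs : List X} → Unique xs → (∀ x → x ∈ xs) →
                   (p q : X → Bool) (f : X → X) → (∀ {x y} → f x ≡ f y → x ≡ y) →
                   (∀ x → p x ≡ true → q (f x) ≡ true) → countB p xs ≤ countB q xs
countB-injection {xs = xs} uniq complete p q f f-inj p⇒q∘f = subst₂ _≤_
  (trans (length-map f (filter p? xs)) (sym (countB≡length∘filter p xs)))
  (sym (countB≡length∘filter q xs))
  (Unique∧⊆⇒length-≤ (Unique.map⁺ f-inj (Unique.filter⁺ p? uniq)) image⊆)
  where
  p? = λ x → p x ≟ᵇ true
  q? = λ x → q x ≟ᵇ true
  image⊆ : ∀ {y} → y ∈ map f (filter p? xs) → y ∈ filter q? xs
  image⊆ y∈ with ∈-map⁻ f y∈
  ... | x , x∈ , refl = ∈-filter⁺ q? (complete (f x)) (p⇒q∘f x (proj₂ (∈-filter⁻ p? {xs = xs} x∈)))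

sumℕ : List X → (X → ℕ) → ℕ
sumℕ []       f = 0
sumℕ (x ∷ xs) f = f x + sumℕ xs f

sumℕ-cong : (xs : List X) {f g : X → ℕ} → (∀ x → f x ≡ g x) → sumℕ xs f ≡ sumℕ xs g
sumℕ-cong []       f≗g = refl
sumℕ-cong (x ∷ xs) f≗g = cong₂ _+_ (f≗g x) (sumℕ-cong xs f≗g)

sumℕ-zero : (xs : List X) {f : X → ℕ} → (∀ x → f x ≡ 0) → sumℕ xs f ≡ 0
sumℕ-zero []       f≗0 = refl
sumℕ-zero (x ∷ xs) f≗0 rewrite f≗0 x = sumℕ-zero xs f≗0

sumℕ-+ : (xs : List X) (f g : X → ℕ) → sumℕ xs (λ x → f x + g x) ≡ sumℕ xs f + sumℕ xs g
sumℕ-+ []       f g = refl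
sumℕ-+ (x ∷ xs) f g rewrite sumℕ-+ xs f g = +-interchange (f x) (g x) (sumℕ xs f) (sumℕ xs g)

sumℕ-if-const : (xs : List X) (g : X → Bool) {F : X → ℕ} {c : ℕ} → (∀ x → F x ≡ c) →
                sumℕ xs (λ x → if g x then F x else 0) ≡ c * countB g xs
sumℕ-if-const []       g {c = c} F≗c = sym (ℕ.*-zeroʳ c)
sumℕ-if-const (x ∷ xs) g {c = c} F≗c with g x
... | true  rewrite F≗c x | sumℕ-if-const xs g F≗c = sym (ℕ.*-suc c (countB g xs))
... | false = sumℕ-if-const xs g F≗c

indicator : Bool → ℕ
indicator b = if b then 1 else 0

sumℕ-∉ : {n : ℕ} {w : Fin n} (F : Fin n → ℕ) {zs : List (Fin n)} → w ∉ zs →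
         sumℕ zs (λ z → if ⌊ w ≟ z ⌋ then F z else 0) ≡ 0
sumℕ-∉ F {[]}     w∉ = refl
sumℕ-∉ {w = w} F {z ∷ zs} w∉ rewrite isYes-false (w ≟ z) (λ w≡z → w∉ (here w≡z)) =
  sumℕ-∉ F (λ w∈ → w∉ (there w∈))

sumℕ-∈ : {n : ℕ} {w : Fin n} (F : Fin n → ℕ) {zs : List (Fin n)} → Unique zs → w ∈ zs →
         sumℕ zs (λ z → if ⌊ w ≟ z ⌋ then F z else 0) ≡ F w
sumℕ-∈ {w = w} F {_ ∷ zs} (w∉zs ∷ _) (here refl) rewrite isYes-complete (w ≟ w) refl =
  trans (cong₂ _+_ refl (sumℕ-∉ F (λ w∈ → All.lookup w∉zs w∈ refl))) (ℕ.+-identityʳ (F w))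
sumℕ-∈ {w = w} F {z ∷ zs} (z∉zs ∷ uniq) (there w∈)
  rewrite isYes-false (w ≟ z) (λ { refl → All.lookup z∉zs w∈ refl }) = sumℕ-∈ F uniq w∈

countB-∷ : (p : X → Bool) (x : X) (xs : List X) → countB p (x ∷ xs) ≡ indicator (p x) + countB p xs
countB-∷ p x xs with p x
... | true  = refl
... | false = refl

if-then-+ : (b : Bool) (m n : ℕ) → (if b then m + n else 0) ≡ (if b then m else 0) + (if b then n else 0)
if-then-+ true  m n = refl
if-then-+ false m n = refl

sumℕ-indicator : {n : ℕ} (g : Fin n → Bool) (b : Bool) (w : Fin n) →
  sumℕ (allFin n) (λ z → if g z then indicator (b ∧ ⌊ w ≟ z ⌋) else 0) ≡ indicator (b ∧ g w)
sumℕ-indicator g false w = sumℕ-zero (allFin _) (λ z → if-eta (g z))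
sumℕ-indicator g true  w = trans
  (sumℕ-cong (allFin _) (λ z → if-swap-then (g z) ⌊ w ≟ z ⌋))
  (sumℕ-∈ (λ z → indicator (g z)) (Unique.allFin⁺ _) (∈-allFin w))

countB-fibres : {X : Set} {n : ℕ} (h : X → Bool) (f : X → Fin n) (g : Fin n → Bool) (xs : List X) →
  countB (λ x → h x ∧ g (f x)) xs
    ≡ sumℕ (allFin n) (λ z → if g z then countB (λ x → h x ∧ ⌊ f x ≟ z ⌋) xs else 0)
countB-fibres h f g [] = sym (sumℕ-zero (allFin _) (λ z → if-eta (g z)))
countB-fibres {X = X} {n = n} h f g (x ∷ xs) = begin
  countB (λ y → h y ∧ g (f y)) (x ∷ xs)
    ≡⟨ countB-∷ _ x xs ⟩
  indicator (h x ∧ g (f x)) + countB (λ y → h y ∧ g (f y)) xs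
    ≡⟨ cong₂ _+_ (sym (sumℕ-indicator g (h x) (f x))) (countB-fibres h f g xs) ⟩
  sumℕ (allFin n) (λ z → if g z then indicator (h x ∧ ⌊ f x ≟ z ⌋) else 0)
    + sumℕ (allFin n) (λ z → if g z then fibre z xs else 0)
    ≡⟨ sumℕ-+ (allFin n) _ _ ⟨
  sumℕ (allFin n) (λ z → (if g z then indicator (h x ∧ ⌊ f x ≟ z ⌋) else 0) + (if g z then fibre z xs else 0))
    ≡⟨ sumℕ-cong (allFin n) (λ z → trans (sym (if-then-+ (g z) _ _))
                                         (cong (λ t → if g z then t else 0) (sym (countB-∷ _ x xs)))) ⟩
  sumℕ (allFin n) (λ z → if g z then fibre z (x ∷ xs) else 0) ∎
  where
  open ≡-Reasoning
  fibre : Fin n → List X → ℕ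
  fibre z = countB (λ y → h y ∧ ⌊ f y ≟ z ⌋)

countB-uniform-fibres : {n : ℕ} (h : X → Bool) (f : X → Fin n) (xs : List X) {c : ℕ} →
  (∀ z → countB (λ x → h x ∧ ⌊ f x ≟ z ⌋) xs ≡ c) →
  (g : Fin n → Bool) → countB (λ x → h x ∧ g (f x)) xs ≡ c * countB g (allFin n)
countB-uniform-fibres h f xs uniform g =
  trans (countB-fibres h f g xs) (sumℕ-if-const (allFin _) g uniform)

-- Rational arithmetic

fromℕ : ℕ → ℚ
fromℕ n = fromℤ (+ n)

fromℕ-mono-≤ : {m n : ℕ} → m ≤ n → fromℕ m ℚ.≤ fromℕ n
fromℕ-mono-≤ {m} {n} m≤n =
  ℚ.*≤* (subst₂ ℤ._≤_ (ℤ.pos-* m 1) (ℤ.pos-* n 1) (ℤ.+≤+ (ℕ.*-monoˡ-≤ 1 m≤n)))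

fromℕ-+ : (m n : ℕ) → fromℕ (m + n) ≡ fromℕ m ℚ.+ fromℕ n
fromℕ-+ m n = ℚ.toℚᵘ-injective (ℚᵘ.≃-sym (ℚᵘ.≃-trans (ℚ.toℚᵘ-homo-+ (fromℕ m) (fromℕ n))
  (ℚᵘ.*≡* (trans (ℤ.*-identityʳ _) (trans (cong₂ ℤ._+_ (ℤ.*-identityʳ (+ m)) (ℤ.*-identityʳ (+ n)))
    (trans (sym (ℤ.pos-+ m n)) (sym (ℤ.*-identityʳ _))))))))

fromℕ-* : (m n : ℕ) → fromℕ (m * n) ≡ fromℕ m ℚ.* fromℕ n
fromℕ-* m n = ℚ.toℚᵘ-injective (ℚᵘ.≃-sym (ℚᵘ.≃-trans (ℚ.toℚᵘ-homo-* (fromℕ m) (fromℕ n))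
  (ℚᵘ.*≡* (cong (ℤ._* + 1) (sym (ℤ.pos-* m n))))))

d/n*n≡d : (d m : ℕ) → ((+ d) / suc m) ℚ.* fromℕ (suc m) ≡ fromℕ d
d/n*n≡d d m = ℚ.toℚᵘ-injective (ℚᵘ.≃-trans (ℚ.toℚᵘ-homo-* ((+ d) / suc m) (fromℕ (suc m)))
  (ℚᵘ.≃-trans (ℚᵘ.*-congʳ {mkℚᵘ (+ suc m) 0} (ℚ.toℚᵘ-fromℚᵘ (mkℚᵘ (+ d) m)))
    (ℚᵘ.*≡* (trans (ℤ.*-identityʳ _) (cong (λ z → + d ℤ.* + z) (cong suc (sym (ℕ.*-identityʳ m))))))))

/-<-/ : (a b c e : ℕ) → a * suc e < c * suc b → ((+ a) / suc b) ℚ.< ((+ c) / suc e)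
/-<-/ a b c e ae<cb = ℚ.toℚᵘ-cancel-<
  (ℚᵘ.<-respˡ-≃ (ℚᵘ.≃-sym (ℚ.toℚᵘ-fromℚᵘ (mkℚᵘ (+ a) b)))
    (ℚᵘ.<-respʳ-≃ (ℚᵘ.≃-sym (ℚ.toℚᵘ-fromℚᵘ (mkℚᵘ (+ c) e)))
      (ℚᵘ.*<* (subst₂ ℤ._<_ (ℤ.pos-* a (suc e)) (ℤ.pos-* c (suc b)) (ℤ.+<+ ae<cb)))))

fromℕ-*-/-≤ : (N k d m : ℕ) → N * d ≤ k * suc m → fromℕ N ℚ.* ((+ d) / suc m) ℚ.≤ fromℕ k
fromℕ-*-/-≤ N k d m Nd≤km =
  ℚ.*-cancelʳ-≤-pos (fromℕ (suc m)) (subst₂ ℚ._≤_ Nd≡ (fromℕ-* k (suc m)) (fromℕ-mono-≤ Nd≤km))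
  where
  open ≡-Reasoning
  Nd≡ : fromℕ (N * d) ≡ fromℕ N ℚ.* ((+ d) / suc m) ℚ.* fromℕ (suc m)
  Nd≡ = begin
    fromℕ (N * d)                                    ≡⟨ fromℕ-* N d ⟩
    fromℕ N ℚ.* fromℕ d                              ≡⟨ cong (fromℕ N ℚ.*_) (d/n*n≡d d m) ⟨
    fromℕ N ℚ.* (((+ d) / suc m) ℚ.* fromℕ (suc m))  ≡⟨ ℚ.*-assoc (fromℕ N) ((+ d) / suc m) (fromℕ (suc m)) ⟨
    fromℕ N ℚ.* ((+ d) / suc m) ℚ.* fromℕ (suc m)    ∎

Σℚ : List X → (X → ℚ) → ℚ
Σℚ xs f = sumℚ (map f xs)

Σℚ-cong : (xs : List X) {f g : X → ℚ} → (∀ x → f x ≡ g x) → Σℚ xs f ≡ Σℚ xs g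
Σℚ-cong []       f≗g = refl
Σℚ-cong (x ∷ xs) f≗g = cong₂ ℚ._+_ (f≗g x) (Σℚ-cong xs f≗g)

Σℚ-zero : (xs : List X) {f : X → ℚ} → (∀ x → f x ≡ 0ℚ) → Σℚ xs f ≡ 0ℚ
Σℚ-zero []       f≗0 = refl
Σℚ-zero (x ∷ xs) f≗0 rewrite f≗0 x | Σℚ-zero xs f≗0 = refl

Σℚ-+ : (xs : List X) (f g : X → ℚ) → Σℚ xs (λ x → f x ℚ.+ g x) ≡ Σℚ xs f ℚ.+ Σℚ xs g
Σℚ-+ []       f g = refl
Σℚ-+ (x ∷ xs) f g rewrite Σℚ-+ xs f g = +-interchangeℚ (f x) (g x) (Σℚ xs f) (Σℚ xs g)

Σℚ-comm : {Y : Set} (xs : List X) (ys : List Y) (f : X → Y → ℚ) →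
          Σℚ xs (λ x → Σℚ ys (f x)) ≡ Σℚ ys (λ y → Σℚ xs (λ x → f x y))
Σℚ-comm []       ys f = sym (Σℚ-zero ys (λ _ → refl))
Σℚ-comm (x ∷ xs) ys f rewrite Σℚ-comm xs ys f = sym (Σℚ-+ ys (f x) (λ y → Σℚ xs (λ x → f x y)))

Σℚ-*ˡ : (xs : List X) (c : ℚ) (f : X → ℚ) → Σℚ xs (λ x → c ℚ.* f x) ≡ c ℚ.* Σℚ xs f
Σℚ-*ˡ []       c f = sym (ℚ.*-zeroʳ c)
Σℚ-*ˡ (x ∷ xs) c f rewrite Σℚ-*ˡ xs c f = sym (ℚ.*-distribˡ-+ c (f x) (Σℚ xs f))

Σℚ-if-const : (xs : List X) (b : X → Bool) (c : ℚ) →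
              Σℚ xs (λ x → if b x then c else 0ℚ) ≡ fromℕ (countB b xs) ℚ.* c
Σℚ-if-const []       b c = sym (ℚ.*-zeroˡ c)
Σℚ-if-const (x ∷ xs) b c with b x
... | true  rewrite Σℚ-if-const xs b c = sym (begin
  fromℕ (suc (countB b xs)) ℚ.* c         ≡⟨ cong (ℚ._* c) (fromℕ-+ 1 (countB b xs)) ⟩
  (1ℚ ℚ.+ fromℕ (countB b xs)) ℚ.* c      ≡⟨ ℚ.*-distribʳ-+ c 1ℚ (fromℕ (countB b xs)) ⟩
  1ℚ ℚ.* c ℚ.+ fromℕ (countB b xs) ℚ.* c  ≡⟨ cong (ℚ._+ fromℕ (countB b xs) ℚ.* c) (ℚ.*-identityˡ c) ⟩
  c ℚ.+ fromℕ (countB b xs) ℚ.* c         ∎)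
  where open ≡-Reasoning
... | false = trans (ℚ.+-identityˡ _) (Σℚ-if-const xs b c)

Σℚ-if : (b : Bool) (xs : List X) (f : X → ℚ) →
        Σℚ xs (λ x → if b then f x else 0ℚ) ≡ (if b then Σℚ xs f else 0ℚ)
Σℚ-if true  xs f = refl
Σℚ-if false xs f = Σℚ-zero xs (λ _ → refl)

Σℚ-mono-≤ : (xs : List X) {f g : X → ℚ} → (∀ x → x ∈ xs → f x ℚ.≤ g x) → Σℚ xs f ℚ.≤ Σℚ xs g
Σℚ-mono-≤ []       f≤g = ℚ.≤-refl
Σℚ-mono-≤ (x ∷ xs) f≤g = ℚ.+-mono-≤ (f≤g x (here refl)) (Σℚ-mono-≤ xs (λ y y∈ → f≤g y (there y∈)))

Σℚ-mono-< : (xs : List X) {f g : X → ℚ} → (∀ x → x ∈ xs → f x ℚ.≤ g x) →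
            {x₀ : X} → x₀ ∈ xs → f x₀ ℚ.< g x₀ → Σℚ xs f ℚ.< Σℚ xs g
Σℚ-mono-< (x ∷ xs) f≤g (here refl) fx<gx =
  ℚ.+-mono-<-≤ fx<gx (Σℚ-mono-≤ xs (λ y y∈ → f≤g y (there y∈)))
Σℚ-mono-< (x ∷ xs) f≤g (there x₀∈) fx₀<gx₀ =
  ℚ.+-mono-≤-< (f≤g x (here refl)) (Σℚ-mono-< xs (λ y y∈ → f≤g y (there y∈)) x₀∈ fx₀<gx₀)

averaging : (xs : List X) (h : X → Bool) (w : X → ℚ) (t : ℚ) {x₀ : X} → x₀ ∈ xs → h x₀ ≡ true →
            fromℕ (countB h xs) ℚ.* t ℚ.≤ Σℚ xs (λ x → if h x then w x else 0ℚ) →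
            ∃ λ x → h x ≡ true × t ℚ.≤ w x
averaging xs h w t {x₀} x₀∈ hx₀ total≥ with Any.any? (λ x → (h x ≟ᵇ true) ×-dec (t ℚ.≤? w x)) xs
... | yes found = satisfied found
... | no none   = ⊥-elim (ℚ.<-irrefl refl (ℚ.<-≤-trans total< total≥))
  where
  below : ∀ x → x ∈ xs → h x ≡ true → w x ℚ.< t
  below x x∈ hx = ℚ.≰⇒> (λ t≤wx → none (lose x∈ (hx , t≤wx)))
  pointwise : ∀ x → x ∈ xs → (if h x then w x else 0ℚ) ℚ.≤ (if h x then t else 0ℚ)
  pointwise x x∈ with h x in hx
  ... | true  = ℚ.<⇒≤ (below x x∈ hx)
  ... | false = ℚ.≤-refl
  total< : Σℚ xs (λ x → if h x then w x else 0ℚ) ℚ.< fromℕ (countB h xs) ℚ.* t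
  total< = subst (_ ℚ.<_) (Σℚ-if-const xs h t)
    (Σℚ-mono-< xs pointwise x₀∈
      (subst (λ b → (if b then w x₀ else 0ℚ) ℚ.< (if b then t else 0ℚ)) (sym hx₀) (below x₀ x₀∈ hx₀)))

-- Arcs, labels and degrees

module _ {k : ℕ} where

  hasLabel-just : (ℓ : Fin (suc k)) → hasLabel (just ℓ) ℓ ≡ true
  hasLabel-just ℓ = isYes-complete (ℓ ≟ ℓ) refl

  hasLabel-sound : (a : Maybe (Fin (suc k))) (ℓ : Fin (suc k)) → hasLabel a ℓ ≡ true → a ≡ just ℓ
  hasLabel-sound (just ℓ′) ℓ h = cong just (isYes-sound (ℓ′ ≟ ℓ) h)

  no-loop : {o : Bool} {V : Set} {G : Graph k V} → InClass o G → (v : V) {ℓ : Fin (suc k)} → G v v ≢ just ℓ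
  no-loop G∈𝒢 v Gvv≡ with () ← trans (sym (proj₁ G∈𝒢 v)) Gvv≡

  -- Antiparallel arcs only occur in the undirected case, where they carry the same label.
  opposite-arc : {o : Bool} {V W : Set} {G : Graph k V} {H : Graph k W} → InClass o G → InClass o H →
                 {u v : V} {a b : W} {ℓ ℓ′ : Fin (suc k)} →
                 G u v ≡ just ℓ → G v u ≡ just ℓ′ → H a b ≡ just ℓ → H b a ≡ just ℓ′
  opposite-arc {false} (_ , G-sym) (_ , H-sym) {u} {v} {a} {b} Guv≡ Gvu≡ Hab≡ =
    trans (sym (H-sym a b)) (trans Hab≡ (trans (sym Guv≡) (trans (G-sym u v) Gvu≡)))
  opposite-arc {true} (_ , G-asym) _ {u} {v} Guv≡ Gvu≡ _ with G-asym u v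
  ... | inj₁ Guv≡nothing with () ← trans (sym Guv≡nothing) Guv≡
  ... | inj₂ Gvu≡nothing with () ← trans (sym Gvu≡nothing) Gvu≡

K₁-hasHomTo : {o : Bool} {k m : ℕ} (G0 : Graph k (Fin (suc m))) (G : Graph k (Fin 1)) → InClass o G → HasHomTo G0 G
K₁-hasHomTo G0 G G∈𝒢 = (λ _ → fzero) , λ { fzero fzero ℓ Gvv≡ → ⊥-elim (no-loop G∈𝒢 fzero Gvv≡) }

module _ {o : Bool} {k m : ℕ} {G0 : Graph k (Fin (suc m))} (G0∈𝒢 : InClass o G0)
         (G : Graph k (Fin 2)) (G∈𝒢 : InClass o G) where

  private
    v₀ v₁ : Fin 2
    v₀ = fzero
    v₁ = fsuc fzero

    two : Fin (suc m) → Fin (suc m) → Fin 2 → Fin (suc m)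
    two a b fzero        = a
    two a b (fsuc fzero) = b

  K₂-arc-hasHomTo : {ℓ : Fin (suc k)} {a b : Fin (suc m)} →
                    G v₀ v₁ ≡ just ℓ → G0 a b ≡ just ℓ → HasHomTo G0 G
  K₂-arc-hasHomTo {a = a} {b} G01≡ G0ab≡ = two a b , hom
    where
    hom : IsHom G G0 (two a b)
    hom fzero        fzero        ℓ Gvv≡ = ⊥-elim (no-loop G∈𝒢 v₀ Gvv≡)
    hom (fsuc fzero) (fsuc fzero) ℓ Gvv≡ = ⊥-elim (no-loop G∈𝒢 v₁ Gvv≡)
    hom fzero        (fsuc fzero) ℓ G01≡′ with refl ← trans (sym G01≡) G01≡′ = G0ab≡
    hom (fsuc fzero) fzero        ℓ G10≡ = opposite-arc G∈𝒢 G0∈𝒢 G01≡ G10≡ G0ab≡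

  K₂-reverse-arc-hasHomTo : {ℓ : Fin (suc k)} {a b : Fin (suc m)} →
                            G v₀ v₁ ≡ nothing → G v₁ v₀ ≡ just ℓ → G0 a b ≡ just ℓ → HasHomTo G0 G
  K₂-reverse-arc-hasHomTo {a = a} {b} G01≡ G10≡ G0ab≡ = two b a , hom
    where
    hom : IsHom G G0 (two b a)
    hom fzero        fzero        ℓ Gvv≡ = ⊥-elim (no-loop G∈𝒢 v₀ Gvv≡)
    hom (fsuc fzero) (fsuc fzero) ℓ Gvv≡ = ⊥-elim (no-loop G∈𝒢 v₁ Gvv≡)
    hom fzero        (fsuc fzero) ℓ G01≡′ with () ← trans (sym G01≡) G01≡′
    hom (fsuc fzero) fzero        ℓ G10≡′ with refl ← trans (sym G10≡) G10≡′ = G0ab≡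

  K₂-hasHomTo : ((ℓ : Fin (suc k)) → Σ (Fin (suc m)) λ a → Σ (Fin (suc m)) λ b → G0 a b ≡ just ℓ) →
                adj G v₀ v₁ ≡ true → HasHomTo G0 G
  K₂-hasHomTo every-label v₀~v₁ with G v₀ v₁ in G01≡ | G v₁ v₀ in G10≡
  ... | just ℓ  | _      = K₂-arc-hasHomTo G01≡ (proj₂ (proj₂ (every-label ℓ)))
  ... | nothing | just ℓ = K₂-reverse-arc-hasHomTo G01≡ G10≡ (proj₂ (proj₂ (every-label ℓ)))
  ... | nothing | nothing with () ← v₀~v₁

incident : (o : Bool) {k : ℕ} {V : Set} → Dir o → Graph k V → V → V → Maybe (Fin (suc k))
incident false _     G v w = G v w
incident true  true  G v w = G v w
incident true  false G v w = G w v

degree≡countB : (o : Bool) {k n : ℕ} (G : Graph k (Fin n)) (v : Fin n) (ℓ : Fin (suc k)) (dr : Dir o) →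
                degree o G v ℓ dr ≡ countB (λ w → hasLabel (incident o dr G v w) ℓ) (allFin n)
degree≡countB false G v ℓ dr    = refl
degree≡countB true  G v ℓ true  = refl
degree≡countB true  G v ℓ false = refl

incident-loop : (o : Bool) {k n : ℕ} (G : Graph k (Fin n)) (dr : Dir o) (v : Fin n) → incident o dr G v v ≡ G v v
incident-loop false G dr    v = refl
incident-loop true  G true  v = refl
incident-loop true  G false v = refl

out : (o : Bool) → Dir o
out false = _
out true  = true

incident-out : (o : Bool) {k n : ℕ} (G : Graph k (Fin n)) (v w : Fin n) → incident o (out o) G v w ≡ G v w
incident-out false G v w = refl
incident-out true  G v w = refl

degree-< : {o : Bool} {k m : ℕ} {G0 : Graph k (Fin (suc m))} → InClass o G0 →
           (v : Fin (suc m)) (ℓ : Fin (suc k)) (dr : Dir o) → degree o G0 v ℓ dr < suc m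
degree-< {o} {G0 = G0} G0∈𝒢 v ℓ dr = subst₂ _<_ (sym (degree≡countB o G0 v ℓ dr)) (length-tabulate (λ w → w))
  (countB-<-length _ (∈-allFin v) (cong (λ a → hasLabel a ℓ) (trans (incident-loop o G0 dr v) (proj₁ G0∈𝒢 v))))

module _ {k n : ℕ} {G0 : Graph k (Fin n)} (vt : VertexTransitive G0)
         {a b : Fin n} {ℓ : Fin (suc k)} (G0ab≡ : G0 a b ≡ just ℓ) where

  out-arc : (v : Fin n) → Σ (Fin n) λ w → G0 v w ≡ just ℓ
  out-arc v with vt a v
  ... | σ , (_ , σ-hom) , refl = σ b , σ-hom a b ℓ G0ab≡

  in-arc : (v : Fin n) → Σ (Fin n) λ w → G0 w v ≡ just ℓ
  in-arc v with vt b v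
  ... | σ , (_ , σ-hom) , refl = σ a , σ-hom a b ℓ G0ab≡

  incident-arc : (o : Bool) (v : Fin n) (dr : Dir o) → Σ (Fin n) λ w → incident o dr G0 v w ≡ just ℓ
  incident-arc false v _     = out-arc v
  incident-arc true  v true  = out-arc v
  incident-arc true  v false = in-arc v

degree-pos : (o : Bool) {k m : ℕ} {G0 : Graph k (Fin (suc m))} → VertexTransitive G0 →
             ((ℓ : Fin (suc k)) → Σ (Fin (suc m)) λ a → Σ (Fin (suc m)) λ b → G0 a b ≡ just ℓ) →
             (v : Fin (suc m)) (ℓ : Fin (suc k)) (dr : Dir o) → 0 < degree o G0 v ℓ dr
degree-pos o {G0 = G0} vt every-label v ℓ dr with incident-arc vt (proj₂ (proj₂ (every-label ℓ))) o v dr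
... | w , arc≡ = subst (0 <_) (sym (degree≡countB o G0 v ℓ dr))
  (countB-pos _ (∈-allFin w) (trans (cong (λ a → hasLabel a ℓ) arc≡) (hasLabel-just ℓ)))

ratio-bounds : (d m : ℕ) → 0 < d → d < suc m → (0ℚ ℚ.< (+ d) / suc m) × ((+ d) / suc m ℚ.< 1ℚ)
ratio-bounds (suc d) m _ d<n0 =
  /-<-/ 0 0 (suc d) m (s≤s z≤n) ,
  /-<-/ (suc d) m 1 0 (subst₂ _<_ (sym (ℕ.*-identityʳ (suc d))) (sym (ℕ.+-identityʳ (suc m))) d<n0)

-- Vertex subsets and walks

module _ {n : ℕ} where

  infix 4 _⊆_
  _⊆_ : Subset n → Subset n → Set
  A ⊆ B = (v : Fin n) → A v ≡ true → B v ≡ true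

  size : Subset n → ℕ
  size B = countB B (allFin n)

  size-≤ : (B : Subset n) → size B ≤ n
  size-≤ B = subst (size B ≤_) (length-tabulate (λ w → w)) (countB-≤-length B (allFin n))

  size-pos : (B : Subset n) {v : Fin n} → B v ≡ true → 0 < size B
  size-pos B {v} Bv = countB-pos B (∈-allFin v) Bv

  size-mono-< : {A B : Subset n} → A ⊆ B → {v : Fin n} → A v ≡ false → B v ≡ true → size A < size B
  size-mono-< {A} {B} A⊆B {v} Av Bv = countB-mono-< A B A⊆B (∈-allFin v) Av Bv

  remove-⊆ : (B : Subset n) (x : Fin n) → remove B x ⊆ B
  remove-⊆ B x v = ∧-conicalˡ (B v) _

  remove-≢ : (B : Subset n) (x : Fin n) {v : Fin n} → remove B x v ≡ true → v ≢ x
  remove-≢ B x {v} B∖x v≡x = true≢false (∧-conicalʳ (B v) _ B∖x) (cong not (isYes-complete (v ≟ x) v≡x))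

  remove-self : (B : Subset n) (x : Fin n) → remove B x x ≡ false
  remove-self B x rewrite isYes-complete (x ≟ x) refl = ∧-zeroʳ (B x)

  remove-keeps : (B : Subset n) (x : Fin n) {v : Fin n} → B v ≡ true → v ≢ x → remove B x v ≡ true
  remove-keeps B x {v} Bv v≢x rewrite Bv | isYes-false (v ≟ x) v≢x = refl

module Walks {k n : ℕ} (G : Graph k (Fin n)) where

  walk-start : {B : Subset n} {u v : Fin n} → Walk G B u v → B u ≡ true
  walk-start (here Bu)     = Bu
  walk-start (step Bu _ _) = Bu

  walk-end : {B : Subset n} {u v : Fin n} → Walk G B u v → B v ≡ true
  walk-end (here Bv)     = Bv
  walk-end (step _ _ wk) = walk-end wk

  walk-mono : {A B : Subset n} → A ⊆ B → {u v : Fin n} → Walk G A u v → Walk G B u v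
  walk-mono A⊆B (here Av)       = here (A⊆B _ Av)
  walk-mono A⊆B (step Au u~ wk) = step (A⊆B _ Au) u~ (walk-mono A⊆B wk)

  walk-snoc : {B : Subset n} {u v w : Fin n} → Walk G B u v → B w ≡ true → adj G v w ≡ true → Walk G B u w
  walk-snoc (here Bv)       Bw v~w = step Bv v~w (here Bw)
  walk-snoc (step Bu u~ wk) Bw v~w = step Bu u~ (walk-snoc wk Bw v~w)

  walk-after-last-visit : {B : Subset n} (x : Fin n) {u v : Fin n} → Walk G B u v →
    Walk G (remove B x) u v ⊎ (x ≡ v ⊎ Σ (Fin n) λ w → adj G x w ≡ true × Walk G (remove B x) w v)
  walk-after-last-visit {B} x {u} (here Bu) with u ≟ x
  ... | yes refl = inj₂ (inj₁ refl)
  ... | no u≢x   = inj₁ (here (remove-keeps B x Bu u≢x))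
  walk-after-last-visit {B} x {u} (step {v = w} Bu u~w wk) with walk-after-last-visit x wk | u ≟ x
  ... | inj₁ wk′ | yes refl = inj₂ (inj₂ (w , u~w , wk′))
  ... | inj₁ wk′ | no u≢x   = inj₁ (step (remove-keeps B x Bu u≢x) u~w wk′)
  ... | inj₂ later | _      = inj₂ later

  -- After its last visit of u, a walk from u to v ≢ u stays inside B ∖ u, which is smaller than B.
  walk?-fuel : (f : ℕ) (B : Subset n) → size B ≤ f → (u v : Fin n) → Dec (Walk G B u v)
  walk?-fuel f B size≤f u v with B u in Bu | u ≟ v
  ... | false | _        = no (λ wk → true≢false (walk-start wk) Bu)
  ... | true  | yes refl = yes (here Bu)
  walk?-fuel zero    B size≤0 u v | true | no _ = ⊥-elim (ℕ.<-irrefl refl (ℕ.<-≤-trans (size-pos B Bu) size≤0))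
  walk?-fuel (suc f) B size≤f u v | true | no u≢v
    with any? (λ w → (adj G u w ≟ᵇ true) ×-dec walk?-fuel f (remove B u) size∖u≤f w v)
    where size∖u≤f = ℕ.≤-pred (ℕ.≤-trans (size-mono-< (remove-⊆ B u) (remove-self B u) Bu) size≤f)
  ... | yes (w , u~w , wk) = yes (step Bu u~w (walk-mono (remove-⊆ B u) wk))
  ... | no none = no (λ wk → from-last-visit (walk-after-last-visit u wk))
    where
    from-last-visit : Walk G (remove B u) u v
                    ⊎ (u ≡ v ⊎ Σ (Fin n) λ w → adj G u w ≡ true × Walk G (remove B u) w v) → ⊥
    from-last-visit (inj₁ wk′)                  = true≢false (walk-start wk′) (remove-self B u)
    from-last-visit (inj₂ (inj₁ u≡v))           = u≢v u≡v
    from-last-visit (inj₂ (inj₂ (w , u~w , wk′))) = none (w , u~w , wk′)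

  walk? : (B : Subset n) (u v : Fin n) → Dec (Walk G B u v)
  walk? B = walk?-fuel n B (size-≤ B)

  Split : Subset n → Set
  Split B = Σ (Fin n) λ u → Σ (Fin n) λ v → B u ≡ true × B v ≡ true × ¬ Walk G B u v

  split? : (B : Subset n) → Dec (Split B)
  split? B = any? λ u → any? λ v → (B u ≟ᵇ true) ×-dec (B v ≟ᵇ true) ×-dec ¬? (walk? B u v)

  connected-or-split : (B : Subset n) → Connected G B ⊎ Split B
  connected-or-split B with split? B
  ... | yes split = inj₂ split
  ... | no ¬split = inj₁ connected
    where
    connected : Connected G B
    connected u v Bu Bv with walk? B u v
    ... | yes wk  = wk
    ... | no ¬wk = ⊥-elim (¬split (u , v , Bu , Bv , ¬wk))

  connected? : (B : Subset n) → Dec (Connected G B)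
  connected? B with connected-or-split B
  ... | inj₁ connected               = yes connected
  ... | inj₂ (u , v , Bu , Bv , ¬wk) = no (λ connected → ¬wk (connected u v Bu Bv))

  CutFree : Subset n → Set
  CutFree B = (x : Fin n) → B x ≡ true → Connected G (remove B x)

  cut-free-or-cut : (B : Subset n) → CutFree B ⊎ Σ (Fin n) λ x → B x ≡ true × Split (remove B x)
  cut-free-or-cut B with any? (λ x → (B x ≟ᵇ true) ×-dec split? (remove B x))
  ... | yes cut = inj₂ cut
  ... | no ¬cut = inj₁ cut-free
    where
    cut-free : CutFree B
    cut-free x Bx with connected-or-split (remove B x)
    ... | inj₁ connected = connected
    ... | inj₂ split     = ⊥-elim (¬cut (x , Bx , split))

  blockLike? : (B : Subset n) → Dec (BlockLike G B)
  blockLike? B = any? (λ v → B v ≟ᵇ true) ×-dec connected? B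
           ×-dec all? (λ x → (B x ≟ᵇ true) →-dec connected? (remove B x))

  blockLike-cong : {A B : Subset n} → (∀ v → A v ≡ B v) → BlockLike G A → BlockLike G B
  blockLike-cong {A} {B} A≗B ((v , Av) , connected , cut-free) =
      (v , ⊆′ v Av) , connected-cong A≗B connected
    , λ x Bx → connected-cong (λ w → cong (λ b → b ∧ not ⌊ w ≟ x ⌋) (A≗B w)) (cut-free x (⊇′ x Bx))
    where
    ⊆′ : A ⊆ B
    ⊆′ v Av = trans (sym (A≗B v)) Av
    ⊇′ : B ⊆ A
    ⊇′ v Bv = trans (A≗B v) Bv
    connected-cong : {A′ B′ : Subset n} → (∀ v → A′ v ≡ B′ v) → Connected G A′ → Connected G B′
    connected-cong A′≗B′ connected u v Bu Bv =
      walk-mono (λ w A′w → trans (sym (A′≗B′ w)) A′w)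
        (connected u v (trans (A′≗B′ u) Bu) (trans (A′≗B′ v) Bv))

  -- B is enlarged while a strictly larger block-like set exists; n ≤ size B + f bounds the number of steps.
  blockLike⇒⊆block-fuel : (f : ℕ) (B : Subset n) → BlockLike G B → n ≤ size B + f →
                          Σ (Subset n) λ B* → IsBlock G B* × B ⊆ B*
  blockLike⇒⊆block-fuel f B blB n≤ with anySubset?
      {P = λ V → B ⊆ lookup V × BlockLike G (lookup V) × Σ (Fin n) λ v → lookup V v ≡ true × B v ≡ false}
      (λ V → all? (λ v → (B v ≟ᵇ true) →-dec (lookup V v ≟ᵇ true)) ×-dec blockLike? (lookup V)
             ×-dec any? (λ v → (lookup V v ≟ᵇ true) ×-dec (B v ≟ᵇ false)))
  ... | no ¬larger = B , (blB , maximal) , (λ _ Bv → Bv)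
    where
    maximal : (B′ : Subset n) → B ⊆ B′ → BlockLike G B′ → B′ ⊆ B
    maximal B′ B⊆B′ blB′ v B′v with B v in Bv
    ... | true  = refl
    ... | false = ⊥-elim (¬larger (vtabulate B′
        , (λ w Bw → trans (lookup∘tabulate B′ w) (B⊆B′ w Bw))
        , blockLike-cong (λ w → sym (lookup∘tabulate B′ w)) blB′
        , v , trans (lookup∘tabulate B′ v) B′v , Bv))
  ... | yes (V , B⊆V , blV , v , Vv , Bv) with f
  ...   | zero  = ⊥-elim (ℕ.<-irrefl refl (ℕ.<-≤-trans (size-mono-< B⊆V Bv Vv)
                    (ℕ.≤-trans (size-≤ (lookup V)) (subst (n ≤_) (ℕ.+-identityʳ (size B)) n≤))))
  ...   | suc f = let (B* , isBlock , V⊆B*) = blockLike⇒⊆block-fuel f (lookup V) blV (ℕ.≤-trans n≤ n≤′)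
                  in B* , isBlock , (λ w Bw → V⊆B* w (B⊆V w Bw))
    where
    n≤′ : size B + suc f ≤ size (lookup V) + f
    n≤′ = subst (_≤ size (lookup V) + f) (sym (ℕ.+-suc (size B) f)) (ℕ.+-monoˡ-≤ f (size-mono-< B⊆V Bv Vv))

  blockLike⇒⊆block : (B : Subset n) → BlockLike G B → Σ (Subset n) λ B* → IsBlock G B* × B ⊆ B*
  blockLike⇒⊆block B blB = blockLike⇒⊆block-fuel n B blB (ℕ.m≤n+m n (size B))

  reach : Subset n → Fin n → Subset n
  reach B u w = ⌊ walk? B u w ⌋

  reach-sound : {B : Subset n} {u w : Fin n} → reach B u w ≡ true → Walk G B u w
  reach-sound {B} {u} {w} = isYes-sound (walk? B u w)

  reach-complete : {B : Subset n} {u w : Fin n} → Walk G B u w → reach B u w ≡ true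
  reach-complete {B} {u} {w} = isYes-complete (walk? B u w)

  reach-false : {B : Subset n} {u w : Fin n} → ¬ Walk G B u w → reach B u w ≡ false
  reach-false {B} {u} {w} = isYes-false (walk? B u w)

  reach-⊆ : (B : Subset n) (u : Fin n) → reach B u ⊆ B
  reach-⊆ B u w Ruw = walk-end (reach-sound Ruw)

  reach-closed : {B : Subset n} {u a b : Fin n} → reach B u a ≡ true → B b ≡ true → adj G a b ≡ true →
                 reach B u b ≡ true
  reach-closed Rua Bb a~b = reach-complete (walk-snoc (reach-sound Rua) Bb a~b)

  reach-self : {B : Subset n} {u : Fin n} → B u ≡ true → reach B u u ≡ true
  reach-self Bu = reach-complete (here Bu)

  Disjoint : Subset n → Subset n → Set
  Disjoint A C = (w : Fin n) → A w ≡ true → C w ≡ false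

  record Separation (T : Subset n) : Set where
    field
      A C       : Subset n
      cover     : (w : Fin n) → T w ≡ true → A w ≡ false → C w ≡ true
      separated : (a b : Fin n) → A a ≡ true → C a ≡ false → C b ≡ true → A b ≡ false → adj G a b ≢ true
      A-smaller : size A < size T
      C-smaller : size C < size T
      shared    : Disjoint A C
                ⊎ Σ (Fin n) λ x → A x ≡ true × C x ≡ true × ((w : Fin n) → A w ≡ true → C w ≡ true → w ≡ x)

  disconnected-separation : (T : Subset n) → Split T → Separation T
  disconnected-separation T (u , v , Tu , Tv , ¬wk) = record
    { A         = R
    ; C         = C
    ; cover     = λ w Tw Rw → cong₂ (λ a b → a ∧ not b) Tw Rw
    ; separated = λ a b Ra _ Cb Rb a~b →
        true≢false (reach-closed Ra (∧-conicalˡ (T b) _ Cb) a~b) Rb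
    ; A-smaller = size-mono-< (reach-⊆ T u) (reach-false ¬wk) Tv
    ; C-smaller = size-mono-< (λ w → ∧-conicalˡ (T w) _)
                    (trans (cong (λ b → T u ∧ not b) (reach-self Tu)) (∧-zeroʳ (T u))) Tu
    ; shared    = inj₁ (λ w Rw → trans (cong (λ b → T w ∧ not b) Rw) (∧-zeroʳ (T w)))
    }
    where
    R C : Subset n
    R = reach T u
    C w = T w ∧ not (R w)

  cut-separation : (T : Subset n) (x : Fin n) → T x ≡ true → Split (remove T x) → Separation T
  cut-separation T x Tx (u , v , T∖x-u , T∖x-v , ¬wk) = record
    { A         = A
    ; C         = C
    ; cover     = λ w Tw Aw → cong₂ (λ a b → a ∧ not b) Tw (∨-conicalˡ (R w) _ Aw)
    ; separated = separated
    ; A-smaller = size-mono-< A⊆T (cong₂ _∨_ (reach-false ¬wk) (isYes-false (v ≟ x) (remove-≢ T x T∖x-v)))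
                    (remove-⊆ T x v T∖x-v)
    ; C-smaller = size-mono-< (λ w → ∧-conicalˡ (T w) _)
                    (trans (cong (λ b → T u ∧ not b) (reach-self T∖x-u)) (∧-zeroʳ (T u))) (remove-⊆ T x u T∖x-u)
    ; shared    = inj₂ (x , Ax , Cx , λ w Aw Cw → A∖R⇒≡x Aw (C⇒¬R Cw))
    }
    where
    R A C : Subset n
    R = reach (remove T x) u
    A w = R w ∨ ⌊ w ≟ x ⌋
    C w = T w ∧ not (R w)

    Rx : R x ≡ false
    Rx = reach-false (λ wk → true≢false (walk-end wk) (remove-self T x))

    A-cases : {w : Fin n} → A w ≡ true → R w ≡ true ⊎ w ≡ x
    A-cases {w} Aw with R w
    ... | true  = inj₁ refl
    ... | false = inj₂ (isYes-sound (w ≟ x) Aw)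

    A∖R⇒≡x : {w : Fin n} → A w ≡ true → R w ≡ false → w ≡ x
    A∖R⇒≡x Aw Rw with A-cases Aw
    ... | inj₁ Rw′ = ⊥-elim (true≢false Rw′ Rw)
    ... | inj₂ w≡x = w≡x

    C⇒¬R : {w : Fin n} → C w ≡ true → R w ≡ false
    C⇒¬R {w} Cw = trans (sym (not-involutive (R w))) (cong not (∧-conicalʳ (T w) _ Cw))

    A⊆T : A ⊆ T
    A⊆T w Aw with A-cases Aw
    ... | inj₁ Rw   = remove-⊆ T x w (reach-⊆ (remove T x) u w Rw)
    ... | inj₂ refl = Tx

    Ax : A x ≡ true
    Ax rewrite isYes-complete (x ≟ x) refl = ∨-zeroʳ (R x)

    Cx : C x ≡ true
    Cx rewrite Tx | Rx = refl

    separated : (a b : Fin n) → A a ≡ true → C a ≡ false → C b ≡ true → A b ≡ false → adj G a b ≢ true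
    separated a b Aa Ca Cb Ab a~b = true≢false (reach-closed Ra T∖x-b a~b) (∨-conicalˡ (R b) _ Ab)
      where
      Ra : R a ≡ true
      Ra with A-cases Aa
      ... | inj₁ Ra′  = Ra′
      ... | inj₂ refl = ⊥-elim (true≢false Cx Ca)
      T∖x-b : remove T x b ≡ true
      T∖x-b = remove-keeps T x (∧-conicalˡ (T b) _ Cb)
                (λ b≡x → true≢false (isYes-complete (b ≟ x) b≡x) (∨-conicalʳ (R b) _ Ab))

  separation-or-blockLike : (T : Subset n) {v : Fin n} → T v ≡ true → Separation T ⊎ BlockLike G T
  separation-or-blockLike T {v} Tv with connected-or-split T
  ... | inj₂ split     = inj₁ (disconnected-separation T split)
  ... | inj₁ connected with cut-free-or-cut T
  ...   | inj₂ (x , Tx , split) = inj₁ (cut-separation T x Tx split)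
  ...   | inj₁ cut-free         = inj₂ ((v , Tv) , connected , cut-free)

-- Gluing homomorphisms along separations

arc⇒adj : {k n : ℕ} (G : Graph k (Fin n)) {u v : Fin n} {ℓ : Fin (suc k)} → G u v ≡ just ℓ → adj G u v ≡ true
arc⇒adj G Guv≡ rewrite Guv≡ = refl

adj-sym : {k n : ℕ} (G : Graph k (Fin n)) (u v : Fin n) → adj G u v ≡ adj G v u
adj-sym G u v = ∨-comm (is-just (G u v)) (is-just (G v u))

elem-irrelevant : {n : ℕ} {B : Subset n} {Y : Set} (φ : Elem B → Y) {v : Fin n} (p q : B v ≡ true) →
                  φ (v , p) ≡ φ (v , q)
elem-irrelevant φ p q = cong (λ r → φ (_ , r)) (uip p q)

module _ {n : ℕ} {Y : Set} {T A C : Subset n} (cover : (w : Fin n) → T w ≡ true → A w ≡ false → C w ≡ true)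
         (f : Elem A → Y) (g : Elem C → Y) where

  private
    pick : (w : Fin n) → T w ≡ true → (b : Bool) → A w ≡ b → Y
    pick w Tw true  Aw = f (w , Aw)
    pick w Tw false Aw = g (w , cover w Tw Aw)

  combine : Elem T → Y
  combine (w , Tw) = pick w Tw (A w) refl

  combine-A : (w : Fin n) (Tw : T w ≡ true) (Aw : A w ≡ true) → combine (w , Tw) ≡ f (w , Aw)
  combine-A w Tw Aw = pick-A (A w) refl
    where
    pick-A : (b : Bool) (Aw≡b : A w ≡ b) → pick w Tw b Aw≡b ≡ f (w , Aw)
    pick-A true  Aw≡b = elem-irrelevant f Aw≡b Aw
    pick-A false Aw≡b = ⊥-elim (true≢false Aw Aw≡b)

  combine-C : (w : Fin n) (Tw : T w ≡ true) (Cw : C w ≡ true) →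
              ((Aw : A w ≡ true) → f (w , Aw) ≡ g (w , Cw)) → combine (w , Tw) ≡ g (w , Cw)
  combine-C w Tw Cw agree = pick-C (A w) refl
    where
    pick-C : (b : Bool) (Aw≡b : A w ≡ b) → pick w Tw b Aw≡b ≡ g (w , Cw)
    pick-C true  Aw≡b = agree Aw≡b
    pick-C false Aw≡b = elem-irrelevant g _ Cw

module BlockDecomposition {k n m : ℕ} (G : Graph k (Fin n)) (G0 : Graph k (Fin (suc m)))
                          (vt : VertexTransitive G0) where

  open Walks G

  HomOn : Subset n → Set
  HomOn B = HasHomTo G0 (induced G B)

  restrict-hom : {A B : Subset n} → A ⊆ B → HomOn B → HomOn A
  restrict-hom A⊆B (φ , φ-hom) =
    (λ (v , Av) → φ (v , A⊆B v Av)) , λ (u , _) (v , _) ℓ Guv≡ → φ-hom _ _ ℓ Guv≡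

  module _ {T : Subset n} (sep : Separation T) where
    open Separation sep

    glue : ((φA , _) : HomOn A) ((φC , _) : HomOn C) (σ : Fin (suc m) → Fin (suc m)) → IsHom G0 G0 σ →
           ((w : Fin n) (Aw : A w ≡ true) (Cw : C w ≡ true) → φA (w , Aw) ≡ σ (φC (w , Cw))) → HomOn T
    glue (φA , φA-hom) (φC , φC-hom) σ σ-hom agree = ψ , ψ-hom
      where
      ψ : Elem T → Fin (suc m)
      ψ = combine cover φA (λ e → σ (φC e))

      ψ-A : (w : Fin n) (Tw : T w ≡ true) (Aw : A w ≡ true) → ψ (w , Tw) ≡ φA (w , Aw)
      ψ-A = combine-A cover φA _

      ψ-C : (w : Fin n) (Tw : T w ≡ true) (Cw : C w ≡ true) → ψ (w , Tw) ≡ σ (φC (w , Cw))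
      ψ-C w Tw Cw = combine-C cover φA _ w Tw Cw (λ Aw → agree w Aw Cw)

      arc-across : {a b : Fin n} → A a ≡ true → A b ≡ false → T b ≡ true → adj G a b ≡ true →
                   C a ≡ true × C b ≡ true
      arc-across {a} {b} Aa Ab Tb a~b with C a in Ca
      ... | true  = refl , cover b Tb Ab
      ... | false = ⊥-elim (separated a b Aa Ca (cover b Tb Ab) Ab a~b)

      arc-inside : {a b : Fin n} → T a ≡ true → T b ≡ true → adj G a b ≡ true →
                   (A a ≡ true × A b ≡ true) ⊎ (C a ≡ true × C b ≡ true)
      arc-inside {a} {b} Ta Tb a~b with A a in Aa | A b in Ab
      ... | true  | true  = inj₁ (refl , refl)
      ... | false | false = inj₂ (cover a Ta Aa , cover b Tb Ab)
      ... | true  | false = inj₂ (arc-across Aa Ab Tb a~b)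
      ... | false | true  = let (Cb , Ca) = arc-across Ab Aa Ta (trans (adj-sym G b a) a~b) in inj₂ (Ca , Cb)

      ψ-hom : IsHom (induced G T) G0 ψ
      ψ-hom (a , Ta) (b , Tb) ℓ Gab≡ with arc-inside Ta Tb (arc⇒adj G Gab≡)
      ... | inj₁ (Aa , Ab) = subst₂ (λ x y → G0 x y ≡ just ℓ) (sym (ψ-A a Ta Aa)) (sym (ψ-A b Tb Ab))
                               (φA-hom (a , Aa) (b , Ab) ℓ Gab≡)
      ... | inj₂ (Ca , Cb) = subst₂ (λ x y → G0 x y ≡ just ℓ) (sym (ψ-C a Ta Ca)) (sym (ψ-C b Tb Cb))
                               (σ-hom _ _ ℓ (φC-hom (a , Ca) (b , Cb) ℓ Gab≡))

    separation-hom : HomOn A → HomOn C → HomOn T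
    separation-hom homA homC with shared
    ... | inj₁ disjoint = glue homA homC (λ z → z) (λ _ _ _ e → e)
                            (λ w Aw Cw → ⊥-elim (true≢false Cw (disjoint w Aw)))
    ... | inj₂ (x , Ax , Cx , only-x) with vt (proj₁ homC (x , Cx)) (proj₁ homA (x , Ax))
    ...   | σ , (_ , σ-hom) , σ-maps = glue homA homC σ σ-hom agree
      where
      agree : (w : Fin n) (Aw : A w ≡ true) (Cw : C w ≡ true) → proj₁ homA (w , Aw) ≡ σ (proj₁ homC (w , Cw))
      agree w Aw Cw with refl ← only-x w Aw Cw =
        trans (elem-irrelevant (proj₁ homA) Aw Ax) (trans (sym σ-maps) (cong σ (elem-irrelevant (proj₁ homC) Cx Cw)))

  module _ (blocks-hom : (B : Subset n) → IsBlock G B → HomOn B) where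

    hom-on-subset-fuel : (f : ℕ) (T : Subset n) → size T ≤ f → HomOn T
    hom-on-subset-fuel f T size≤f with any? (λ v → T v ≟ᵇ true)
    ... | no empty = (λ _ → fzero) , λ (v , Tv) _ _ _ → ⊥-elim (empty (v , Tv))
    ... | yes (v , Tv) with separation-or-blockLike T Tv
    ...   | inj₂ blT = let (B* , isBlock , T⊆B*) = blockLike⇒⊆block T blT
                       in restrict-hom T⊆B* (blocks-hom B* isBlock)
    ...   | inj₁ sep with f
    ...     | zero  = ⊥-elim (ℕ.<-irrefl refl (ℕ.<-≤-trans (size-pos T Tv) size≤f))
    ...     | suc f = separation-hom sep
                        (hom-on-subset-fuel f A (ℕ.≤-pred (ℕ.≤-trans A-smaller size≤f)))
                        (hom-on-subset-fuel f C (ℕ.≤-pred (ℕ.≤-trans C-smaller size≤f)))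
      where open Separation sep

    hom-on-subset : (T : Subset n) → HomOn T
    hom-on-subset T = hom-on-subset-fuel n T (size-≤ T)

  hasHomTo⇔blocks-hasHomTo : HasHomTo G0 G ⇔ ((B : Subset n) → IsBlock G B → HasHomTo G0 (induced G B))
  hasHomTo⇔blocks-hasHomTo = mk⇔
    (λ (φ , φ-hom) B _ → (λ (v , _) → φ v) , λ (u , _) (v , _) ℓ Guv≡ → φ-hom u v ℓ Guv≡)
    (λ blocks-hom → let (ψ , ψ-hom) = hom-on-subset blocks-hom (λ _ → true)
                    in (λ v → ψ (v , refl)) , λ u v ℓ Guv≡ → ψ-hom (u , refl) (v , refl) ℓ Guv≡)

-- Endomorphisms of a vertex-transitive graph

vectorsOver : {X : Set} → List X → (j : ℕ) → List (Vec X j)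
vectorsOver xs zero    = Vec.[] ∷ []
vectorsOver xs (suc j) = cartesianProductWith Vec._∷_ xs (vectorsOver xs j)

vectorsOver-unique : {X : Set} {xs : List X} → Unique xs → (j : ℕ) → Unique (vectorsOver xs j)
vectorsOver-unique uniq zero    = All.[] ∷ []
vectorsOver-unique uniq (suc j) = Unique.cartesianProductWith⁺ Vec._∷_ ∷-injective uniq (vectorsOver-unique uniq j)

vectorsOver-complete : {X : Set} {xs : List X} → (∀ x → x ∈ xs) → {j : ℕ} (V : Vec X j) → V ∈ vectorsOver xs j
vectorsOver-complete complete Vec.[]       = here refl
vectorsOver-complete complete (x Vec.∷ V) =
  ∈-cartesianProductWith⁺ Vec._∷_ (complete x) (vectorsOver-complete complete V)

module Endomorphisms {k m : ℕ} (G0 : Graph k (Fin (suc m))) (vt : VertexTransitive G0) where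

  -- All self-maps of the vertex set, as tables of values.
  maps : List (Vec (Fin (suc m)) (suc m))
  maps = vectorsOver (allFin (suc m)) (suc m)

  maps-complete : (V : Vec (Fin (suc m)) (suc m)) → V ∈ maps
  maps-complete = vectorsOver-complete ∈-allFin

  endo? : (f : Fin (suc m) → Fin (suc m)) → Dec (IsHom G0 G0 f)
  endo? f = all? λ u → all? λ v → all? λ ℓ →
    ≡-decMaybe _≟_ (G0 u v) (just ℓ) →-dec ≡-decMaybe _≟_ (G0 (f u) (f v)) (just ℓ)

  isEndo : Vec (Fin (suc m)) (suc m) → Bool
  isEndo V = ⌊ endo? (lookup V) ⌋

  N : ℕ
  N = countB isEndo maps

  identity : Vec (Fin (suc m)) (suc m)
  identity = vtabulate (λ i → i)

  isEndo-identity : isEndo identity ≡ true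
  isEndo-identity = isYes-complete (endo? (lookup identity)) λ u v ℓ G0uv≡ →
    subst₂ (λ a b → G0 a b ≡ just ℓ) (sym (lookup∘tabulate (λ i → i) u)) (sym (lookup∘tabulate (λ i → i) v))
      G0uv≡

  endos-sending : Fin (suc m) → Fin (suc m) → ℕ
  endos-sending y z = countB (λ V → isEndo V ∧ ⌊ lookup V y ≟ z ⌋) maps

  -- Composing with an automorphism τ with τ z = z′ maps the endomorphisms sending y to z
  -- injectively to those sending y to z′.
  endos-sending-≤ : (y z z′ : Fin (suc m)) → endos-sending y z ≤ endos-sending y z′
  endos-sending-≤ y z z′ with vt z z′
  ... | τ , ((τ-injective , _) , τ-hom) , τz≡z′ =
    countB-injection (vectorsOver-unique (Unique.allFin⁺ (suc m)) (suc m)) maps-complete _ _ τ∘ τ∘-injective sends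
    where
    τ∘ : Vec (Fin (suc m)) (suc m) → Vec (Fin (suc m)) (suc m)
    τ∘ V = vtabulate (λ i → τ (lookup V i))
    lookup-τ∘ : (V : Vec (Fin (suc m)) (suc m)) (i : Fin (suc m)) → lookup (τ∘ V) i ≡ τ (lookup V i)
    lookup-τ∘ V = lookup∘tabulate (λ i → τ (lookup V i))
    τ∘-injective : ∀ {V W} → τ∘ V ≡ τ∘ W → V ≡ W
    τ∘-injective {V} {W} τV≡τW = trans (sym (tabulate∘lookup V)) (trans (tabulate-cong λ i →
      τ-injective (trans (sym (lookup-τ∘ V i)) (trans (cong (λ X → lookup X i) τV≡τW) (lookup-τ∘ W i))))
      (tabulate∘lookup W))
    sends : (V : Vec (Fin (suc m)) (suc m)) → isEndo V ∧ ⌊ lookup V y ≟ z ⌋ ≡ true →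
            isEndo (τ∘ V) ∧ ⌊ lookup (τ∘ V) y ≟ z′ ⌋ ≡ true
    sends V endo∧sends = cong₂ _∧_
      (isYes-complete (endo? (lookup (τ∘ V))) λ u v ℓ G0uv≡ →
        subst₂ (λ a b → G0 a b ≡ just ℓ) (sym (lookup-τ∘ V u)) (sym (lookup-τ∘ V v))
          (τ-hom _ _ ℓ (isYes-sound (endo? (lookup V)) (∧-conicalˡ (isEndo V) _ endo∧sends) u v ℓ G0uv≡)))
      (isYes-complete (lookup (τ∘ V) y ≟ z′)
        (trans (lookup-τ∘ V y)
          (trans (cong τ (isYes-sound (lookup V y ≟ z) (∧-conicalʳ (isEndo V) _ endo∧sends))) τz≡z′)))

  endos-sending-uniform : (y z : Fin (suc m)) → endos-sending y z ≡ endos-sending y fzero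
  endos-sending-uniform y z = ℕ.≤-antisym (endos-sending-≤ y z fzero) (endos-sending-≤ y fzero z)

  endos-landing-in : (y : Fin (suc m)) (g : Fin (suc m) → Bool) →
                     countB (λ V → isEndo V ∧ g (lookup V y)) maps * suc m ≡ N * countB g (allFin (suc m))
  endos-landing-in y g = begin
    countB (λ V → isEndo V ∧ g (lookup V y)) maps * suc m   ≡⟨ cong (_* suc m) (fibres g) ⟩
    c * countB g (allFin (suc m)) * suc m                    ≡⟨ ℕ.*-assoc c _ (suc m) ⟩
    c * (countB g (allFin (suc m)) * suc m)                  ≡⟨ cong (c *_) (ℕ.*-comm _ (suc m)) ⟩
    c * (suc m * countB g (allFin (suc m)))                  ≡⟨ ℕ.*-assoc c (suc m) _ ⟨
    c * suc m * countB g (allFin (suc m))                    ≡⟨ cong (_* countB g (allFin (suc m))) N≡ ⟨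
    N * countB g (allFin (suc m))                            ∎
    where
    open ≡-Reasoning
    c : ℕ
    c = endos-sending y fzero
    fibres : (g : Fin (suc m) → Bool) →
             countB (λ V → isEndo V ∧ g (lookup V y)) maps ≡ c * countB g (allFin (suc m))
    fibres = countB-uniform-fibres isEndo (λ V → lookup V y) maps (endos-sending-uniform y)
    N≡ : N ≡ c * suc m
    N≡ = trans (countB-cong (λ V → sym (∧-identityʳ (isEndo V))) maps)
               (trans (fibres (λ _ → true))
                 (cong (c *_) (trans (countB-true (allFin (suc m))) (length-tabulate (λ i → i)))))

-- The extension property

arc-preserved : {k : ℕ} → Maybe (Fin (suc k)) → Maybe (Fin (suc k)) → Bool
arc-preserved nothing  _ = true
arc-preserved (just ℓ) b = hasLabel b ℓ

keepSym-symmetric : {n : ℕ} (keep : Fin n → Fin n → Bool) → (∀ u v → keep u v ≡ keep v u) →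
                    (u v : Fin n) → keepSym keep u v ≡ keep u v
keepSym-symmetric keep keep-sym u v with toℕ u ℕ.<ᵇ toℕ v
... | true  = refl
... | false = keep-sym v u

edge-kept-at : {k m n : ℕ} (G0 : Graph k (Fin (suc m))) (G : Graph k (Fin n)) (a b : Fin n) (x z : Fin (suc m)) → Bool
edge-kept-at G0 G a b x z = arc-preserved (G a b) (G0 x z) ∧ arc-preserved (G b a) (G0 z x)

edge-kept-at-sym : {k m n : ℕ} (G0 : Graph k (Fin (suc m))) (G : Graph k (Fin n)) (a b : Fin n) (x z : Fin (suc m)) →
                   edge-kept-at G0 G a b x z ≡ edge-kept-at G0 G b a z x
edge-kept-at-sym G0 G a b x z = ∧-comm (arc-preserved (G a b) (G0 x z)) _

edge-kept-count-out : {o : Bool} {k m n : ℕ} {G0 : Graph k (Fin (suc m))} {G : Graph k (Fin n)} →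
  InClass o G0 → InClass o G → (a b : Fin n) (x : Fin (suc m)) {ℓ : Fin (suc k)} → G a b ≡ just ℓ →
  {d : ℕ} → d ≤ degree o G0 x ℓ (out o) → d ≤ countB (edge-kept-at G0 G a b x) (allFin (suc m))
edge-kept-count-out {o} {k} {m} {G0 = G0} {G} G0∈𝒢 G∈𝒢 a b x {ℓ} Gab≡ d≤degree =
  ℕ.≤-trans d≤degree (subst (_≤ _) (sym (degree≡countB o G0 x ℓ (out o))) (countB-mono _ _ kept (allFin _)))
  where
  kept : (z : Fin (suc m)) → hasLabel (incident o (out o) G0 x z) ℓ ≡ true → edge-kept-at G0 G a b x z ≡ true
  kept z has-ℓ = by-reverse-arc (G b a) refl
    where
    G0xz≡ : G0 x z ≡ just ℓ
    G0xz≡ = hasLabel-sound _ ℓ (subst (λ e → hasLabel e ℓ ≡ true) (incident-out o G0 x z) has-ℓ)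
    by-reverse-arc : (e : Maybe (Fin (suc k))) → G b a ≡ e → edge-kept-at G0 G a b x z ≡ true
    by-reverse-arc nothing   Gba≡ rewrite Gab≡ | Gba≡ | G0xz≡ = cong (_∧ true) (hasLabel-just ℓ)
    by-reverse-arc (just ℓ′) Gba≡ rewrite Gab≡ | Gba≡ | G0xz≡ | opposite-arc G∈𝒢 G0∈𝒢 Gab≡ Gba≡ G0xz≡ =
      cong₂ _∧_ (hasLabel-just ℓ) (hasLabel-just ℓ′)

edge-kept-count-in : (o : Bool) {k m n : ℕ} {G0 : Graph k (Fin (suc m))} {G : Graph k (Fin n)} →
  InClass o G → (a b : Fin n) (x : Fin (suc m)) {ℓ : Fin (suc k)} → G a b ≡ nothing → G b a ≡ just ℓ →
  {d : ℕ} → ((dr : Dir o) → d ≤ degree o G0 x ℓ dr) → d ≤ countB (edge-kept-at G0 G a b x) (allFin (suc m))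
edge-kept-count-in false (_ , G-sym) a b x Gab≡ Gba≡ _ with () ← trans (sym Gab≡) (trans (G-sym a b) Gba≡)
edge-kept-count-in true {G0 = G0} {G} _ a b x {ℓ} Gab≡ Gba≡ d≤degree =
  ℕ.≤-trans (d≤degree false) (countB-mono (λ z → hasLabel (G0 z x) ℓ) (edge-kept-at G0 G a b x) kept (allFin _))
  where
  kept : (z : Fin _) → hasLabel (G0 z x) ℓ ≡ true → edge-kept-at G0 G a b x z ≡ true
  kept z has-ℓ =
    trans (cong₂ (λ e e′ → arc-preserved e (G0 x z) ∧ arc-preserved e′ (G0 z x)) Gab≡ Gba≡) has-ℓ

-- The targets joined to x like b to a (at least d of them) keep the edge {a, b}.
edge-kept-count : {o : Bool} {k m n : ℕ} {G0 : Graph k (Fin (suc m))} → InClass o G0 →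
  {d : ℕ} → ((v : Fin (suc m)) (ℓ : Fin (suc k)) (dr : Dir o) → d ≤ degree o G0 v ℓ dr) →
  {G : Graph k (Fin n)} → InClass o G → (a b : Fin n) (x : Fin (suc m)) → adj G a b ≡ true →
  d ≤ countB (edge-kept-at G0 G a b x) (allFin (suc m))
edge-kept-count {o} {k} {m} {G0 = G0} G0∈𝒢 {d} d≤degree {G} G∈𝒢 a b x a~b = by-arcs (G a b) refl (G b a) refl
  where
  by-arcs : (e : Maybe (Fin (suc k))) → G a b ≡ e → (e′ : Maybe (Fin (suc k))) → G b a ≡ e′ →
            d ≤ countB (edge-kept-at G0 G a b x) (allFin (suc m))
  by-arcs (just ℓ) Gab≡ _        _    = edge-kept-count-out G0∈𝒢 G∈𝒢 a b x Gab≡ (d≤degree x ℓ (out o))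
  by-arcs nothing  Gab≡ (just ℓ) Gba≡ = edge-kept-count-in o G∈𝒢 a b x Gab≡ Gba≡ (d≤degree x ℓ)
  by-arcs nothing  Gab≡ nothing  Gba≡
    with () ← trans (sym (cong₂ (λ p q → is-just p ∨ is-just q) Gab≡ Gba≡)) a~b

module Extension {o : Bool} {k m n : ℕ} {G0 : Graph k (Fin (suc m))} (G0∈𝒢 : InClass o G0) (vt : VertexTransitive G0)
  {d : ℕ} (d≤degree : (v : Fin (suc m)) (ℓ : Fin (suc k)) (dr : Dir o) → d ≤ degree o G0 v ℓ dr)
  {G : Graph k (Fin n)} (G∈𝒢 : InClass o G) (S : Subset n)
  (φ₁ : Elem S → Fin (suc m)) (φ₁-hom : IsHom (induced G S) G0 φ₁)
  (φ₂ : Elem (λ v → not (S v)) → Fin (suc m)) (φ₂-hom : IsHom (induced G (λ v → not (S v))) G0 φ₂)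
  where

  open Endomorphisms G0 vt

  ψ : (Fin (suc m) → Fin (suc m)) → Fin n → Fin (suc m)
  ψ σ w = combine {T = λ _ → true} (λ _ _ Sw → cong not Sw) φ₁ (λ e → σ (φ₂ e)) (w , refl)

  ψ-S : (σ : Fin (suc m) → Fin (suc m)) {w : Fin n} (Sw : S w ≡ true) → ψ σ w ≡ φ₁ (w , Sw)
  ψ-S σ {w} = combine-A _ φ₁ _ w refl

  ψ-∁S : (σ : Fin (suc m) → Fin (suc m)) {w : Fin n} (Sw : S w ≡ false) → ψ σ w ≡ σ (φ₂ (w , cong not Sw))
  ψ-∁S σ {w} Sw = combine-C _ φ₁ _ w refl (cong not Sw) (λ Sw′ → ⊥-elim (true≢false Sw′ Sw))

  keep : (Fin (suc m) → Fin (suc m)) → Fin n → Fin n → Bool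
  keep σ u v = edge-kept-at G0 G u v (ψ σ u) (ψ σ v)

  ψ-hom-inside : {σ : Fin (suc m) → Fin (suc m)} → IsHom G0 G0 σ → (u v : Fin n) → crossing S u v ≡ false →
                 {ℓ : Fin (suc k)} → G u v ≡ just ℓ → G0 (ψ σ u) (ψ σ v) ≡ just ℓ
  ψ-hom-inside {σ} σ-hom u v same {ℓ} Guv≡ = by-sides (S u) (S v) refl refl same
    where
    by-sides : (s t : Bool) → S u ≡ s → S v ≡ t → s xor t ≡ false → G0 (ψ σ u) (ψ σ v) ≡ just ℓ
    by-sides true  true  Su Sv _ = subst₂ (λ x y → G0 x y ≡ just ℓ) (sym (ψ-S σ Su)) (sym (ψ-S σ Sv))
                                     (φ₁-hom (u , Su) (v , Sv) ℓ Guv≡)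
    by-sides false false Su Sv _ = subst₂ (λ x y → G0 x y ≡ just ℓ) (sym (ψ-∁S σ Su)) (sym (ψ-∁S σ Sv))
                                     (σ-hom _ _ ℓ (φ₂-hom (u , cong not Su) (v , cong not Sv) ℓ Guv≡))
    by-sides true  false _  _  ()
    by-sides false true  _  _  ()

  ψ-hom : {σ : Fin (suc m) → Fin (suc m)} → IsHom G0 G0 σ → IsHom (deleteCut G S (keep σ)) G0 (ψ σ)
  ψ-hom {σ} σ-hom u v ℓ arc with crossing S u v in cross | keepSym (keep σ) u v in kept
  ... | false | _     = ψ-hom-inside σ-hom u v cross arc
  ... | true  | true  = hasLabel-sound _ ℓ
    (subst (λ e → arc-preserved e (G0 (ψ σ u) (ψ σ v)) ≡ true) arc
      (∧-conicalˡ _ _ (trans (sym (keepSym-symmetric (keep σ) (λ u v → edge-kept-at-sym G0 G u v _ _) u v)) kept)))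
  ... | true  | false with () ← arc

  keeping : Fin n → Fin n → ℕ
  keeping u v = countB (λ V → isEndo V ∧ keep (lookup V) u v) maps

  keeping-≥-from-S : (a b : Fin n) → S a ≡ true → S b ≡ false → adj G a b ≡ true →
                     N * d ≤ keeping a b * suc m
  keeping-≥-from-S a b Sa Sb a~b = begin
    N * d
      ≤⟨ ℕ.*-monoʳ-≤ N (edge-kept-count G0∈𝒢 d≤degree G∈𝒢 a b x a~b) ⟩
    N * countB (edge-kept-at G0 G a b x) (allFin (suc m))
      ≡⟨ endos-landing-in y (edge-kept-at G0 G a b x) ⟨
    countB (λ V → isEndo V ∧ edge-kept-at G0 G a b x (lookup V y)) maps * suc m
      ≡⟨ cong (_* suc m) (countB-cong (λ V → cong (isEndo V ∧_) (kept≡ V)) maps) ⟨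
    keeping a b * suc m ∎
    where
    open ℕ.≤-Reasoning
    x y : Fin (suc m)
    x = φ₁ (a , Sa)
    y = φ₂ (b , cong not Sb)
    kept≡ : (V : Vec (Fin (suc m)) (suc m)) → keep (lookup V) a b ≡ edge-kept-at G0 G a b x (lookup V y)
    kept≡ V = cong₂ (edge-kept-at G0 G a b) (ψ-S (lookup V) Sa) (ψ-∁S (lookup V) Sb)

  keeping-≥ : (u v : Fin n) → isEdgeRep G u v ≡ true → crossing S u v ≡ true → N * d ≤ keeping u v * suc m
  keeping-≥ u v rep cross = by-side (S u) (S v) refl refl cross
    where
    u~v : adj G u v ≡ true
    u~v = ∧-conicalʳ _ _ rep
    by-side : (s t : Bool) → S u ≡ s → S v ≡ t → s xor t ≡ true → N * d ≤ keeping u v * suc m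
    by-side true  false Su Sv _ = keeping-≥-from-S u v Su Sv u~v
    by-side false true  Su Sv _ = subst (λ c → N * d ≤ c * suc m)
      (countB-cong (λ V → cong (isEndo V ∧_) (edge-kept-at-sym G0 G v u _ _)) maps)
      (keeping-≥-from-S v u Sv Su (trans (adj-sym G v u) u~v))
    by-side true  true  _  _  ()
    by-side false false _  _  ()

  module _ (c : Fin n → Fin n → ℚ) (c-pos : (u v : Fin n) → isEdgeRep G u v ≡ true → 0ℚ ℚ.< c u v) where

    ratio : ℚ
    ratio = (+ d) / suc m

    cut-term : Fin n × Fin n → ℚ
    cut-term (u , v) = if isEdgeRep G u v ∧ crossing S u v then c u v else 0ℚ

    kept-term : (Fin (suc m) → Fin (suc m)) → Fin n × Fin n → ℚ
    kept-term σ (u , v) = if isEdgeRep G u v ∧ crossing S u v ∧ keep σ u v then c u v else 0ℚ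

    no-cut-edge : fromℕ N ℚ.* ratio ℚ.* 0ℚ ℚ.≤ Σℚ maps (λ V → if isEndo V then 0ℚ else 0ℚ)
    no-cut-edge =
      ℚ.≤-reflexive (trans (ℚ.*-zeroʳ (fromℕ N ℚ.* ratio)) (sym (Σℚ-zero maps (λ V → if-eta (isEndo V)))))

    pair-bound : (π : Fin n × Fin n) →
                 fromℕ N ℚ.* ratio ℚ.* cut-term π
                 ℚ.≤ Σℚ maps (λ V → if isEndo V then kept-term (lookup V) π else 0ℚ)
    pair-bound (u , v) with isEdgeRep G u v in rep | crossing S u v in cross
    ... | true  | true  = begin
      fromℕ N ℚ.* ratio ℚ.* c u v
        ≤⟨ ℚ.*-monoʳ-≤-nonNeg (c u v) {{ℚ.nonNegative (ℚ.<⇒≤ (c-pos u v rep))}}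
             (fromℕ-*-/-≤ N (keeping u v) d m (keeping-≥ u v rep cross)) ⟩
      fromℕ (keeping u v) ℚ.* c u v
        ≡⟨ Σℚ-if-const maps (λ V → isEndo V ∧ keep (lookup V) u v) (c u v) ⟨
      Σℚ maps (λ V → if isEndo V ∧ keep (lookup V) u v then c u v else 0ℚ)
        ≡⟨ Σℚ-cong maps (λ V → if-∧ (isEndo V)) ⟩
      Σℚ maps (λ V → if isEndo V then (if keep (lookup V) u v then c u v else 0ℚ) else 0ℚ) ∎
      where open ℚ.≤-Reasoning
    ... | true  | false = no-cut-edge
    ... | false | _     = no-cut-edge

    endos-kept-cost : fromℕ N ℚ.* (ratio ℚ.* cutCost G S c)
                      ℚ.≤ Σℚ maps (λ V → if isEndo V then keptCost G S (keep (lookup V)) c else 0ℚ)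
    endos-kept-cost = begin
      fromℕ N ℚ.* (ratio ℚ.* Σℚ (pairs n) cut-term)
        ≡⟨ ℚ.*-assoc (fromℕ N) ratio _ ⟨
      fromℕ N ℚ.* ratio ℚ.* Σℚ (pairs n) cut-term
        ≡⟨ Σℚ-*ˡ (pairs n) (fromℕ N ℚ.* ratio) cut-term ⟨
      Σℚ (pairs n) (λ π → fromℕ N ℚ.* ratio ℚ.* cut-term π)
        ≤⟨ Σℚ-mono-≤ (pairs n) (λ π _ → pair-bound π) ⟩
      Σℚ (pairs n) (λ π → Σℚ maps (λ V → if isEndo V then kept-term (lookup V) π else 0ℚ))
        ≡⟨ Σℚ-comm (pairs n) maps _ ⟩
      Σℚ maps (λ V → Σℚ (pairs n) (λ π → if isEndo V then kept-term (lookup V) π else 0ℚ))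
        ≡⟨ Σℚ-cong maps (λ V → Σℚ-if (isEndo V) (pairs n) (kept-term (lookup V))) ⟩
      Σℚ maps (λ V → if isEndo V then Σℚ (pairs n) (kept-term (lookup V)) else 0ℚ) ∎
      where open ℚ.≤-Reasoning

    extension : Σ (Fin n → Fin n → Bool) λ kept →
                (ratio ℚ.* cutCost G S c ℚ.≤ keptCost G S kept c) × HasHomTo G0 (deleteCut G S kept)
    extension with averaging maps isEndo (λ V → keptCost G S (keep (lookup V)) c) (ratio ℚ.* cutCost G S c)
                     (maps-complete identity) isEndo-identity endos-kept-cost
    ... | V , endo , bound = keep (lookup V) , bound , ψ (lookup V) , ψ-hom (isYes-sound (endo? (lookup V)) endo)

mainTheorem10 : (o : Bool) (k m : ℕ) (G0 : Graph k (Fin (suc m))) →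
    InClass o G0 → VertexTransitive G0 →
    ((ℓ : Fin (suc k)) → Σ (Fin (suc m)) λ u → Σ (Fin (suc m)) λ v → G0 u v ≡ just ℓ) →
    (d : ℕ) →
    ((v : Fin (suc m)) (ℓ : Fin (suc k)) (dr : Dir o) → d ≤ degree o G0 v ℓ dr) →
    (Σ (Fin (suc m)) λ v → Σ (Fin (suc k)) λ ℓ → Σ (Dir o) λ dr → degree o G0 v ℓ dr ≡ d) →
    StronglyExtendible o k ((+ d) / suc m) (HasHomTo G0)
mainTheorem10 o k m G0 G0∈𝒢 vt every-label d d≤degree (v , ℓ , dr , degree≡d) =
    ratio-bounds d m (subst (0 <_) degree≡d (degree-pos o vt every-label v ℓ dr))
                     (subst (_< suc m) degree≡d (degree-< G0∈𝒢 v ℓ dr))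
  , K₁-hasHomTo G0
  , (λ G G∈𝒢 → K₂-hasHomTo G0∈𝒢 G G∈𝒢 every-label)
  , (λ n G _ → BlockDecomposition.hasHomTo⇔blocks-hasHomTo G G0 vt)
  , λ n G G∈𝒢 S (φ₁ , φ₁-hom) (φ₂ , φ₂-hom) →
      Extension.extension G0∈𝒢 vt d≤degree G∈𝒢 S φ₁ φ₁-hom φ₂ φ₂-hom
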